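{- Let $\delta,k\in\mathbb{Z}^+$ with $\delta>0$. Set $\alpha'=2^k/\delta+1$ and $\varepsilon=\delta-2^k\%\delta$. Then $\alpha'\cdot\delta=2^k+\varepsilon$, and for every $n\in\mathbb{Z}$: $\alpha'\cdot n/2^k=n/\delta$ if and only if $0\le\varepsilon\cdot(n/\delta)+\alpha'\cdot(n\%\delta)<2^k$.
   Context: For $n,\delta\in\mathbb{Z}$ with $\delta\neq0$, $n/\delta$ and $n\%\delta$ denote the quotient and remainder of Euclidean division: the unique integers $q,s$ with $n=q\cdot\delta+s$ and $0\le s<|\delta|$. The operators $\cdot$, $/$, $\%$ have equal precedence and associate left to right. $\mathbb{Z}^+=\{x\in\mathbb{Z}: x\ge0\}$. -}

module Defs where

-- Write n = s + q δ with q = n / δ and s = n % δ. Since α′ δ = 2^k + ε, multiplying by α′ gives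
-- α′ n = (ε q + α′ s) + q 2^k, so by uniqueness of Euclidean division the quotient of α′ n by 2^k
-- is q exactly when ε q + α′ s is a valid remainder, i.e. lies in [0, 2^k).
module Submission where

open import Defs
open import Data.Nat.Properties using (m^n≢0)
open import Data.Nat as ℕ using (ℕ; NonZero)
open import Data.Integer using (ℤ; +_; _+_; _*_; _≤_; _<_; _/ℕ_; _%ℕ_)
open import Data.Product using (_×_)
open import Function.Bundles using (_⇔_)
open import Relation.Binary.PropositionalEquality using (_≡_)

open import Algebra.Bundles using (AbelianGroup)
open import Data.Empty using (⊥-elim)
open import Data.Integer using (+≤+; +<+; suc)
open import Data.Integer.DivMod using (a≡a%ℕn+[a/ℕn]*n; n%ℕd<d)
open import Data.Integer.Tactic.RingSolver using (solve-∀)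
open import Data.Nat.DivMod using (m≡m%n+[m/n]*n; m%n<n)
import Data.Nat.Properties as ℕ
import Data.Integer.Properties as ℤ
open import Data.Product using (_,_)
open import Function.Bundles using (mk⇔)
open import Relation.Binary.Definitions using (tri<; tri≈; tri>)
open import Relation.Binary.PropositionalEquality using (refl; sym; trans; cong; subst; module ≡-Reasoning)

open import Algebra.Properties.Group (AbelianGroup.group ℤ.+-0-abelianGroup)
  using (∙-cancelʳ)

[m/n+1]*n≡m+[n∸m%n] : ∀ m n .{{_ : NonZero n}} →
                      (m ℕ./ n ℕ.+ 1) ℕ.* n ≡ m ℕ.+ (n ℕ.∸ m ℕ.% n)
[m/n+1]*n≡m+[n∸m%n] m n = begin
  (q ℕ.+ 1) ℕ.* n          ≡⟨ ℕ.*-distribʳ-+ n q 1 ⟩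
  q ℕ.* n ℕ.+ 1 ℕ.* n      ≡⟨ cong (q ℕ.* n ℕ.+_) (ℕ.*-identityˡ n) ⟩
  q ℕ.* n ℕ.+ n            ≡⟨ cong (q ℕ.* n ℕ.+_) (sym (ℕ.m+[n∸m]≡n (ℕ.<⇒≤ (m%n<n m n)))) ⟩
  q ℕ.* n ℕ.+ (r ℕ.+ e)    ≡⟨ sym (ℕ.+-assoc (q ℕ.* n) r e) ⟩
  q ℕ.* n ℕ.+ r ℕ.+ e      ≡⟨ cong (ℕ._+ e) (ℕ.+-comm (q ℕ.* n) r) ⟩
  r ℕ.+ q ℕ.* n ℕ.+ e      ≡⟨ cong (ℕ._+ e) (sym (m≡m%n+[m/n]*n m n)) ⟩
  m ℕ.+ e                  ∎
  where
  open ≡-Reasoning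
  q r e : ℕ
  q = m ℕ./ n
  r = m ℕ.% n
  e = n ℕ.∸ r

t+q*d<r+q′*d : ∀ d {t r q q′ : ℤ} → t < + d → + 0 ≤ r → q < q′ → t + q * + d < r + q′ * + d
t+q*d<r+q′*d d {t} {r} {q} {q′} t<d 0≤r q<q′ = begin-strict
  t + q * + d        <⟨ ℤ.+-monoˡ-< (q * + d) t<d ⟩
  + d + q * + d      ≡⟨ sym (ℤ.suc-* q (+ d)) ⟩
  suc q * + d        ≤⟨ ℤ.*-monoʳ-≤-nonNeg (+ d) (ℤ.i<j⇒suc[i]≤j q<q′) ⟩
  q′ * + d           ≡⟨ sym (ℤ.+-identityˡ (q′ * + d)) ⟩
  + 0 + q′ * + d     ≤⟨ ℤ.+-monoˡ-≤ (q′ * + d) 0≤r ⟩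
  r + q′ * + d       ∎
  where open ℤ.≤-Reasoning

quotient-unique : ∀ d {r t q q′ : ℤ} → + 0 ≤ r → r < + d → + 0 ≤ t → t < + d →
                  r + q * + d ≡ t + q′ * + d → q ≡ q′
quotient-unique d {q = q} {q′} 0≤r r<d 0≤t t<d eq with ℤ.<-cmp q q′
... | tri≈ _ q≡q′ _ = q≡q′
... | tri< q<q′ _ _ = ⊥-elim (ℤ.<-irrefl eq (t+q*d<r+q′*d d r<d 0≤t q<q′))
... | tri> _ _ q>q′ = ⊥-elim (ℤ.<-irrefl (sym eq) (t+q*d<r+q′*d d t<d 0≤r q>q′))

/ℕ≡⇔remainder-bounds : ∀ d .{{_ : NonZero d}} {x t q : ℤ} → x ≡ t + q * + d →
                       (x /ℕ d ≡ q) ⇔ (+ 0 ≤ t × t < + d)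
/ℕ≡⇔remainder-bounds d {x} {t} {q} x≡t+qd = mk⇔ bounds (λ (0≤t , t<d) →
  quotient-unique d 0≤r r<d 0≤t t<d (trans (sym x≡r+q′d) x≡t+qd))
  where
  r q′ : ℤ
  r = + (x %ℕ d)
  q′ = x /ℕ d
  0≤r : + 0 ≤ r
  0≤r = +≤+ ℕ.z≤n
  r<d : r < + d
  r<d = +<+ (n%ℕd<d x d)
  x≡r+q′d : x ≡ r + q′ * + d
  x≡r+q′d = a≡a%ℕn+[a/ℕn]*n x d
  bounds : q′ ≡ q → + 0 ≤ t × t < + d
  bounds refl = subst (+ 0 ≤_) r≡t 0≤r , subst (_< + d) r≡t r<d
    where
    r≡t : r ≡ t
    r≡t = ∙-cancelʳ (q * + d) r t (trans (sym x≡r+q′d) x≡t+qd)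

*-rescale-decomposition : ∀ a d D e {s q : ℤ} → a * d ≡ D + e →
                          a * (s + q * d) ≡ (e * q + a * s) + q * D
*-rescale-decomposition a d D e {s} {q} ad≡D+e = begin
  a * (s + q * d)          ≡⟨ distribute a s q d ⟩
  a * s + q * (a * d)      ≡⟨ cong (λ z → a * s + q * z) ad≡D+e ⟩
  a * s + q * (D + e)      ≡⟨ regroup a s q D e ⟩
  (e * q + a * s) + q * D  ∎
  where
  open ≡-Reasoning
  distribute : ∀ a s q d → a * (s + q * d) ≡ a * s + q * (a * d)
  distribute = solve-∀
  regroup : ∀ a s q D e → a * s + q * (D + e) ≡ (e * q + a * s) + q * D
  regroup = solve-∀

lemma3 : (δ k : ℕ) .{{_ : NonZero δ}} →
    let α′ = (2 ℕ.^ k) ℕ./ δ ℕ.+ 1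
        ε = δ ℕ.∸ (2 ℕ.^ k) ℕ.% δ
    in (α′ ℕ.* δ ≡ 2 ℕ.^ k ℕ.+ ε)
       × ((n : ℤ) →
           ((((+ α′) * n) /ℕ (2 ℕ.^ k)) {{m^n≢0 2 k}} ≡ n /ℕ δ)
           ⇔ ((+ 0 ≤ (+ ε) * (n /ℕ δ) + (+ α′) * (+ (n %ℕ δ)))
              × ((+ ε) * (n /ℕ δ) + (+ α′) * (+ (n %ℕ δ)) < + (2 ℕ.^ k))))
lemma3 δ k = α′δ≡D+ε , λ n → /ℕ≡⇔remainder-bounds D {{m^n≢0 2 k}} (α′n-decomposition n)
  where
  D α′ ε : ℕ
  D = 2 ℕ.^ k
  α′ = D ℕ./ δ ℕ.+ 1
  ε = δ ℕ.∸ D ℕ.% δ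
  α′δ≡D+ε : α′ ℕ.* δ ≡ D ℕ.+ ε
  α′δ≡D+ε = [m/n+1]*n≡m+[n∸m%n] D δ
  α′δ≡D+ε′ : + α′ * + δ ≡ + D + + ε
  α′δ≡D+ε′ = trans (sym (ℤ.pos-* α′ δ)) (trans (cong +_ α′δ≡D+ε) (ℤ.pos-+ D ε))
  α′n-decomposition : ∀ n → + α′ * n ≡ (+ ε * (n /ℕ δ) + + α′ * + (n %ℕ δ)) + (n /ℕ δ) * + D
  α′n-decomposition n = trans (cong (+ α′ *_) (a≡a%ℕn+[a/ℕn]*n n δ))
                              (*-rescale-decomposition (+ α′) (+ δ) (+ D) (+ ε) α′δ≡D+ε′)
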